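{- Every tree-like grand-coalition-first action model is $z$-representable by a tree-like single-coalition-first neighborhood model.
   Context: $AG$ is a finite nonempty set of agents, $AP$ a countable set of atomic propositions. For a nonempty set $AC$ and $C\subseteq AG$, $JA_C$ is the set of functions $\sigma_C:C\to AC$ ($JA_\emptyset=\{\emptyset\}$); $\sigma_C\subseteq\sigma_{AG}$ means $\sigma_C$ is the restriction of $\sigma_{AG}$ to $C$. A grand-coalition-first action model is $M=(ST,AC,out_{AG},L)$ with $ST,AC$ nonempty, $out_{AG}:ST\times JA_{AG}\to\mathcal P(ST)$, $L:ST\to\mathcal P(AP)$. It determines $out_C(s,\sigma_C)=\bigcup\{out_{AG}(s,\sigma_{AG})\mid\sigma_C\subseteq\sigma_{AG}\}$, $av_C(s)=\{\sigma_C\mid out_C(s,\sigma_C)\neq\emptyset\}$, $AE_C(s)=\{out_C(s,\sigma_C)\mid\sigma_C\in av_C(s)\}$. An $AG$-history from $s_0$ to $s_n$ is $(s_0)$ (from $s_0$ to $s_0$) or $(s_0,\sigma^1,s_1,\dots,\sigma^n,s_n)$, $n\ge1$, with $\sigma^{i+1}\in av_{AG}(s_i)$, $s_{i+1}\in out_{AG}(s_i,\sigma^{i+1})$. $M$ is tree-like if there is $r\in ST$ such that for every $s\in ST$ there is a unique $AG$-history from $r$ to $s$. A single-coalition-first neighborhood model is $N=(ST,suc,\{nei_a\}_{a\in AG},L)$ with $suc:ST\to\mathcal P(ST)$ and each $nei_a(s)\subseteq\mathcal P(ST)$ a cover of $suc(s)$ (union $suc(s)$, $\emptyset\notin nei_a(s)$).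 With $\Delta_1\odot\Delta_2=\{Y_1\cap Y_2\mid Y_i\in\Delta_i,Y_1\cap Y_2\neq\emptyset\}$ (extended to finitely many families, $\bigodot\{\Delta\}=\Delta$): $nei_C(s)=\emptyset$ if $suc(s)=\emptyset$; $\{suc(s)\}$ if $suc(s)\neq\emptyset$, $C=\emptyset$; $\bigodot\{nei_a(s)\mid a\in C\}$ otherwise. A $C$-history in $N$ from $s_0$ to $s_n$ is $(s_0)$ or $(s_0,Y_1,s_1,\dots,Y_n,s_n)$, $n\ge1$, with $Y_{i+1}\in nei_C(s_i)$, $s_{i+1}\in Y_{i+1}$. $N$ is tree-like if there is $r\in ST$ such that for every $a\in AG$ and $s\in ST$ there is a unique $\{a\}$-history from $r$ to $s$. $M$ is $z$-representable by $N$ if they share $ST$ and $L$ and $AE_C=nei_C$ for all $C\subseteq AG$. -}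

module Defs where

open import Level using (Level; _⊔_) renaming (suc to lsuc; zero to lzero)
open import Data.Nat using (ℕ; suc)
open import Data.Fin using (Fin)
open import Data.Fin.Subset using (Subset; _∈_; Empty; Nonempty)
open import Data.Product using (Σ; ∃; _×_; _,_)
open import Data.Sum using (_⊎_)
open import Data.Unit using (⊤)
open import Data.Empty using (⊥)
open import Relation.Binary.PropositionalEquality using (_≡_)

-- Conventions
--  * The agents are AG = Fin (suc n)  (a finite nonempty set).
--  * Coalitions C ⊆ AG are  Subset (suc n).
--  * A subset of a type X is a predicate  X → Set;  "≠ ∅" is read as
--    "inhabited".  A family of subsets (element of P(P(X))) is a
--    predicate  (X → Set) → Set.
--  * Sets of states are compared extensionally (_≃_), families of sets
--    are compared as sets of sets modulo extensional equality (_≐_).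

Agent : ℕ → Set
Agent n = Fin (suc n)

Coalition : ℕ → Set
Coalition n = Subset (suc n)

Pow : Set → Set₁
Pow X = X → Set

Fam : Set → Set₁
Fam X = Pow X → Set

Inhabited : {X : Set} → Pow X → Set
Inhabited {X} Y = Σ X Y

_≃_ : {X : Set} → Pow X → Pow X → Set
_≃_ {X} Y Z = (x : X) → (Y x → Z x) × (Z x → Y x)

_≐_ : {ℓ ℓ' : Level} {X : Set} → (Pow X → Set ℓ) → (Pow X → Set ℓ') →
      Set (lsuc lzero ⊔ ℓ ⊔ ℓ')
_≐_ {X = X} F G =
  ((Y : Pow X) → F Y → Σ (Pow X) λ Z → G Z × (Y ≃ Z)) ×
  ((Z : Pow X) → G Z → Σ (Pow X) λ Y → F Y × (Y ≃ Z))

JA : (n : ℕ) → Set → Coalition n → Set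
JA n AC C = (a : Agent n) → a ∈ C → AC

JAG : ℕ → Set → Set
JAG n AC = Agent n → AC

_⊑_ : {n : ℕ} {AC : Set} {C : Coalition n} → JA n AC C → JAG n AC → Set
_⊑_ {n} {AC} {C} σC σ = (a : Agent n) (p : a ∈ C) → σC a p ≡ σ a

_≗J_ : {n : ℕ} {AC : Set} → JAG n AC → JAG n AC → Set
_≗J_ {n} σ σ' = (a : Agent n) → σ a ≡ σ' a

record ActionModel (n : ℕ) (AP : Set) : Set₁ where
  field
    ST     : Set
    AC     : Set
    st₀    : ST          -- ST nonempty
    ac₀    : AC          -- AC nonempty
    outAG  : ST → JAG n AC → Pow ST
    L      : ST → Pow AP

  out : (C : Coalition n) → ST → JA n AC C → Pow ST
  out C s σC x = Σ (JAG n AC) λ σ → (σC ⊑ σ) × outAG s σ x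

  av : (C : Coalition n) → ST → JA n AC C → Set
  av C s σC = Inhabited (out C s σC)

  AE : (C : Coalition n) → ST → Fam ST
  AE C s Y = Σ (JA n AC C) λ σC → av C s σC × (Y ≃ out C s σC)

  data Hist (r : ST) : ST → Set where
    start : Hist r r
    step  : {s t : ST} → Hist r s → (σ : JAG n AC) →
            Inhabited (outAG s σ) → outAG s σ t → Hist r t

  HEq : {r s s' : ST} → Hist r s → Hist r s' → Set
  HEq start start = ⊤
  HEq start (step _ _ _ _) = ⊥
  HEq (step _ _ _ _) start = ⊥
  HEq (step {s₁} {t} h σ _ _) (step {s₁'} {t'} h' σ' _ _) =
    (t ≡ t') × (σ ≗J σ') × HEq h h'

  TreeLike : Set
  TreeLike = Σ ST λ r → (s : ST) →
    Σ (Hist r s) λ h → (h' : Hist r s) → HEq h' h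

record NbhdModel (n : ℕ) (AP : Set) (ST : Set) : Set₁ where
  field
    succ  : ST → Pow ST
    nei   : Agent n → ST → Fam ST
    cover-⊆ : (a : Agent n) (s : ST) (Y : Pow ST) → nei a s Y →
              (x : ST) → Y x → succ s x
    cover-⊇ : (a : Agent n) (s x : ST) → succ s x →
              Σ (Pow ST) λ Y → nei a s Y × Y x
    nonempty : (a : Agent n) (s : ST) (Y : Pow ST) → nei a s Y → Inhabited Y
    L     : ST → Pow AP

  ⊙nei : (C : Coalition n) → ST → Pow ST → Set₁
  ⊙nei C s Y =
    Σ ((a : Agent n) → a ∈ C → Pow ST) λ f →
      ((a : Agent n) (p : a ∈ C) → nei a s (f a p)) ×
      (Y ≃ (λ x → (a : Agent n) (p : a ∈ C) → f a p x)) ×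
      Inhabited Y

  neiC : (C : Coalition n) → ST → Pow ST → Set₁
  neiC C s Y =
    (Empty C × Inhabited (succ s) × (Y ≃ succ s)) ⊎
    (Nonempty C × ⊙nei C s Y)

  -- {a}-histories from r to s  (nei_{{a}} = ⊙{nei_a} = nei_a)
  data Hist (a : Agent n) (r : ST) : ST → Set₁ where
    start : Hist a r r
    step  : {s t : ST} → Hist a r s → (Y : Pow ST) → nei a s Y → Y t →
            Hist a r t

  HEq : {a : Agent n} {r s s' : ST} → Hist a r s → Hist a r s' → Set
  HEq start start = ⊤
  HEq start (step _ _ _ _) = ⊥
  HEq (step _ _ _ _) start = ⊥
  HEq (step {s₁} {t} h Y _ _) (step {s₁'} {t'} h' Y' _ _) =
    (t ≡ t') × (Y ≃ Y') × HEq h h'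

  TreeLike : Set₁
  TreeLike = Σ ST λ r → (a : Agent n) (s : ST) →
    Σ (Hist a r s) λ h → (h' : Hist a r s) → HEq h' h

ZRep : {n : ℕ} {AP : Set} (M : ActionModel n AP) →
       NbhdModel n AP (ActionModel.ST M) → Set₁
ZRep M N =
  (NbhdModel.L N ≡ ActionModel.L M) ×
  ((C : Coalition _) (s : ActionModel.ST M) →
     ActionModel.AE M C s ≐ NbhdModel.neiC N C s)

{-# OPTIONS --safe #-}
-- Let N have the same states and labels as M, with nei_a(s) the nonempty sets
-- out_a(s, c) of states reachable from s by a joint action in which agent a
-- plays c.  Replacing each joint action of an AG-history by the set of
-- outcomes of its a-component gives an {a}-history of N, and every
-- {a}-history arises in this way; so N is tree-like whenever M is.  In a tree
-- every state has a unique incoming joint action, hence a state lies in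
-- ⋂_{a ∈ C} out_a(s, σ_C(a)) iff its incoming joint action extends σ_C, i.e.
-- iff it lies in out_C(s, σ_C).  This is nei_C = AE_C for nonempty C; for
-- C = ∅ both sides are {suc(s)}.
module Submission where

open import Defs
open import Data.Nat using (ℕ)
open import Data.Fin.Subset using (_∈_; Empty; Nonempty)
open import Data.Fin.Subset.Properties using (nonempty?)
open import Data.Product using (Σ; _×_; _,_; proj₁; proj₂; swap)
open import Data.Sum using (inj₁; inj₂)
open import Data.Unit using (tt)
open import Data.Empty using (⊥-elim)
open import Function using (id; _∘_)
open import Function.Bundles using (_↣_)
open import Relation.Nullary using (yes; no)
open import Relation.Binary.PropositionalEquality
  using (_≡_; refl; sym; trans; subst; cong₂)

module _ {X : Set} where

  ≃-refl : {Y : Pow X} → Y ≃ Y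
  ≃-refl _ = id , id

  ≃-sym : {Y Z : Pow X} → Y ≃ Z → Z ≃ Y
  ≃-sym Y≃Z x = swap (Y≃Z x)

  ≃-trans : {Y Z W : Pow X} → Y ≃ Z → Z ≃ W → Y ≃ W
  ≃-trans Y≃Z Z≃W x =
    proj₁ (Z≃W x) ∘ proj₁ (Y≃Z x) , proj₂ (Y≃Z x) ∘ proj₂ (Z≃W x)

  ≃-inhabited : {Y Z : Pow X} → Y ≃ Z → Inhabited Y → Inhabited Z
  ≃-inhabited Y≃Z (x , x∈Y) = x , proj₁ (Y≃Z x) x∈Y

  ⋂ : {n : ℕ} {C : Coalition n} → ((a : Agent n) → a ∈ C → Pow X) → Pow X
  ⋂ {n} {C} f x = (a : Agent n) (p : a ∈ C) → f a p x

  ⋂-cong : {n : ℕ} {C : Coalition n} {f g : (a : Agent n) → a ∈ C → Pow X} →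
           ((a : Agent n) (p : a ∈ C) → f a p ≃ g a p) → ⋂ f ≃ ⋂ g
  ⋂-cong f≃g x = (λ x∈f a p → proj₁ (f≃g a p x) (x∈f a p))
               , (λ x∈g a p → proj₂ (f≃g a p x) (x∈g a p))

module _ {n : ℕ} {AC : Set} {C : Coalition n} (empty : Empty C) where

  emptyJA : JA n AC C
  emptyJA a p = ⊥-elim (empty (a , p))

  ⊑-empty : (σC : JA n AC C) (σ : JAG n AC) → σC ⊑ σ
  ⊑-empty _ _ a p = ⊥-elim (empty (a , p))

module AgentNeighbourhoods {n : ℕ} {AP : Set} (M : ActionModel n AP) where
  open ActionModel M

  succ : ST → Pow ST
  succ s x = Σ (JAG n AC) λ σ → outAG s σ x

  outₐ : Agent n → ST → AC → Pow ST
  outₐ a s c x = Σ (JAG n AC) λ σ → (σ a ≡ c) × outAG s σ x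

  neiₐ : Agent n → ST → Fam ST
  neiₐ a s Y = Σ AC λ c → Inhabited (outₐ a s c) × (Y ≃ outₐ a s c)

  outₐ∈neiₐ : ∀ {a s σ t} → outAG s σ t → neiₐ a s (outₐ a s (σ a))
  outₐ∈neiₐ {t = t} o = _ , (t , _ , refl , o) , ≃-refl

  nbhdModel : NbhdModel n AP ST
  nbhdModel = record
    { succ     = succ
    ; nei      = neiₐ
    ; cover-⊆  = λ { a s Y (c , _ , Y≃) x x∈Y →
                       let (σ , _ , o) = proj₁ (Y≃ x) x∈Y in σ , o }
    ; cover-⊇  = λ { a s x (σ , o) → outₐ a s (σ a) , outₐ∈neiₐ o , (σ , refl , o) }
    ; nonempty = λ { a s Y (c , inh , Y≃) → ≃-inhabited (≃-sym Y≃) inh }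
    ; L        = L
    }

  module N = NbhdModel nbhdModel

  HEq-end : ∀ {r s s'} {h : Hist r s} {h' : Hist r s'} → HEq h h' → s ≡ s'
  HEq-end {h = start}        {start}        _       = refl
  HEq-end {h = start}        {step _ _ _ _} ()
  HEq-end {h = step _ _ _ _} {start}        ()
  HEq-end {h = step _ _ _ _} {step _ _ _ _} (t≡ , _) = t≡

  module _ (a : Agent n) {r : ST} where

    toAgentHist : ∀ {s} → Hist r s → N.Hist a r s
    toAgentHist start          = N.start
    toAgentHist (step h σ _ o) = N.step (toAgentHist h) _ (outₐ∈neiₐ o) (σ , refl , o)

    toJointHist : ∀ {s} → N.Hist a r s → Hist r s
    toJointHist N.start = start
    toJointHist (N.step {t = t} h Y (c , _ , Y≃) t∈Y) =
      let (σ , _ , o) = proj₁ (Y≃ t) t∈Y in step (toJointHist h) σ (t , o) o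

    HEq-toJointHist : ∀ {s s'} (h : N.Hist a r s) (h' : Hist r s') →
                      HEq (toJointHist h) h' → N.HEq h (toAgentHist h')
    HEq-toJointHist N.start            start            _ = tt
    HEq-toJointHist N.start            (step _ _ _ _)   ()
    HEq-toJointHist (N.step _ _ _ _)   start            ()
    HEq-toJointHist (N.step {t = t} h Y (c , _ , Y≃) t∈Y) (step h' σ' _ _)
                    (t≡ , σ≗σ' , h≈h') =
      t≡ , subst (Y ≃_) (cong₂ (outₐ a) (HEq-end h≈h') c≡σ'a) Y≃ , HEq-toJointHist h h' h≈h'
      where
        c≡σ'a : c ≡ σ' a
        c≡σ'a = trans (sym (proj₁ (proj₂ (proj₁ (Y≃ t) t∈Y)))) (σ≗σ' a)

  treeLike : TreeLike → N.TreeLike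
  treeLike (r , unique) = r , λ a s →
    toAgentHist a (proj₁ (unique s)) ,
    λ h → HEq-toJointHist a h _ (proj₂ (unique s) (toJointHist a h))

  step-actions-≗J : ∀ {r s₁ s₂ t t'} {h₁ : Hist r s₁} {h₂ : Hist r s₂} {σ₁ σ₂ i₁ i₂}
                      {o₁ : outAG s₁ σ₁ t} {o₂ : outAG s₂ σ₂ t} (k : Hist r t') →
                    HEq (step h₁ σ₁ i₁ o₁) k → HEq (step h₂ σ₂ i₂ o₂) k → σ₁ ≗J σ₂
  step-actions-≗J (step _ _ _ _) (_ , σ₁≗τ , _) (_ , σ₂≗τ , _) a = trans (σ₁≗τ a) (sym (σ₂≗τ a))

  incoming-unique : TreeLike → ∀ {s s' t σ σ'} → outAG s σ t → outAG s' σ' t → σ ≗J σ'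
  incoming-unique (r , unique) {s} {s'} {t} o o' =
    step-actions-≗J (proj₁ (unique t))
      (proj₂ (unique t) (step (proj₁ (unique s)) _ (t , o) o))
      (proj₂ (unique t) (step (proj₁ (unique s')) _ (t , o') o'))

  module _ {C : Coalition n} {s : ST} {σC : JA n AC C} where

    out⊆⋂outₐ : ∀ {x} → out C s σC x → ⋂ (λ a p → outₐ a s (σC a p)) x
    out⊆⋂outₐ (σ , σC⊑σ , o) a p = σ , sym (σC⊑σ a p) , o

    ⋂outₐ⊆out : TreeLike → Nonempty C →
                ∀ {x} → ⋂ (λ a p → outₐ a s (σC a p)) x → out C s σC x
    ⋂outₐ⊆out tree (a₀ , p₀) x∈⋂ =
      let (σ₀ , _ , o₀) = x∈⋂ a₀ p₀ in
      σ₀ , (λ a p → let (τ , τa≡σCa , o) = x∈⋂ a p in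
                    trans (sym τa≡σCa) (incoming-unique tree o o₀ a)) , o₀

    out≃⋂outₐ : TreeLike → Nonempty C → out C s σC ≃ ⋂ (λ a p → outₐ a s (σC a p))
    out≃⋂outₐ tree ne _ = out⊆⋂outₐ , ⋂outₐ⊆out tree ne

    out≃succ : Empty C → out C s σC ≃ succ s
    out≃succ empty _ = (λ (σ , _ , o) → σ , o) , (λ (σ , o) → σ , ⊑-empty empty σC σ , o)

  AE⊆neiC : TreeLike → ∀ {C s Y} → AE C s Y → N.neiC C s Y
  AE⊆neiC tree {C} {s} {Y} (σC , inh , Y≃) with nonempty? C
  ... | yes ne =
    inj₂ (ne , (λ a p → outₐ a s (σC a p)) , outₐ∈nei , Y≃⋂ , ≃-inhabited (≃-sym Y≃) inh)
    where
      Y≃⋂ : Y ≃ ⋂ (λ a p → outₐ a s (σC a p))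
      Y≃⋂ = ≃-trans Y≃ (out≃⋂outₐ tree ne)
      outₐ∈nei : (a : Agent n) (p : a ∈ C) → neiₐ a s (outₐ a s (σC a p))
      outₐ∈nei a p = let (x , x∈out) = inh in σC a p , (x , out⊆⋂outₐ x∈out a p) , ≃-refl
  ... | no empty =
    inj₁ (empty , ≃-inhabited (out≃succ empty) inh , ≃-trans Y≃ (out≃succ empty))

  neiC⊆AE : TreeLike → ∀ {C s Z} → N.neiC C s Z → Σ (Pow ST) λ Y → AE C s Y × (Y ≃ Z)
  neiC⊆AE _ {C} {s} (inj₁ (empty , inh , Z≃succ)) =
    out C s (emptyJA empty) ,
    (emptyJA empty , ≃-inhabited (≃-sym (out≃succ empty)) inh , ≃-refl) ,
    ≃-trans (out≃succ empty) (≃-sym Z≃succ)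
  neiC⊆AE tree {C} {s} {Z} (inj₂ (ne , f , f∈nei , Z≃⋂f , inh)) =
    out C s σC , (σC , ≃-inhabited (≃-sym out≃Z) inh , ≃-refl) , out≃Z
    where
      σC : JA n AC C
      σC a p = proj₁ (f∈nei a p)
      out≃Z : out C s σC ≃ Z
      out≃Z = ≃-trans (out≃⋂outₐ tree ne)
                (≃-trans (⋂-cong λ a p → ≃-sym (proj₂ (proj₂ (f∈nei a p)))) (≃-sym Z≃⋂f))

  zRep : TreeLike → ZRep M nbhdModel
  zRep tree = refl , λ C s → (λ Y Y∈AE → Y , AE⊆neiC tree Y∈AE , ≃-refl) , (λ _ → neiC⊆AE tree)

theorem6p9 : (n : ℕ) (AP : Set) → AP ↣ ℕ →
    (M : ActionModel n AP) → ActionModel.TreeLike M →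
    Σ (NbhdModel n AP (ActionModel.ST M)) λ N →
    NbhdModel.TreeLike N × ZRep M N
theorem6p9 n AP _ M tree = nbhdModel , treeLike tree , zRep tree
  where open AgentNeighbourhoods M
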